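{- Let $(G_1,\mathbf{w}_1),\dots,(G_k,\mathbf{w}_k)$ be connected weighted graphs with $c(G_i,\mathbf{w}_i)=\mathrm{diam}_{\mathbf{w}_i}(G_i)$ for all $1\le i\le k$. Then $c\big(\square_{i=1}^{k} G_i,\square_{i=1}^{k}\mathbf{w}_i\big)=\sum_{i=1}^{k} c(G_i,\mathbf{w}_i)$.
   Context: A weighted graph is a finite simple graph with positive integer edge weights that is weight-minimal: every edge is a shortest path between its endpoints. $d_\mathbf{w}$ is the weighted shortest-path distance, $\mathrm{diam}_\mathbf{w}(G)=\max_{u,v}d_\mathbf{w}(u,v)$. A binary addressing of length $m$ is a map $f:V\to\{0,1\}^m$ with $d_\mathbf{w}(u,v)\le d_H(f(u),f(v))$ for all $u,v$ ($d_H$ Hamming distance); $c(G,\mathbf{w})$ is the minimum such $m$. The weighted Cartesian product $(G_1\square G_2,\mathbf{w}_1\square\mathbf{w}_2)$ has vertex set $V(G_1)\times V(G_2)$; $(u,x)$ and $(v,x)$ are joined by an edge of weight $\mathbf{w}_1(uv)$ when $uv\in E(G_1)$, and $(u,x)$ and $(u,y)$ by an edge of weight $\mathbf{w}_2(xy)$ when $xy\in E(G_2)$; iterated products are defined analogously. -}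

module Defs where

open import Data.Nat using (ℕ; zero; suc; _+_; _*_; _≤_; _<_)
open import Data.Fin using (Fin; zero; suc; remQuot; _≟_)
open import Data.Bool using (Bool; true; false; if_then_else_)
open import Data.Vec using (Vec; []; _∷_; tabulate; sum)
open import Data.Product using (Σ; ∃; ∃-syntax; _×_; _,_; proj₁; proj₂)
open import Relation.Nullary using (does)
open import Relation.Binary.PropositionalEquality using (_≡_)

-- A raw weighted graph on vertex set Fin n.  wt u v is the weight of the
-- edge uv; wt u v ≡ 0 encodes "uv is not an edge" (edge weights are
-- positive integers, so this is unambiguous).
record RawWG : Set where
  field
    n  : ℕ
    wt : Fin n → Fin n → ℕ
open RawWG public

Edge : (G : RawWG) → Fin (n G) → Fin (n G) → Set
Edge G u v = 0 < wt G u v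

data Walk (G : RawWG) : Fin (n G) → Fin (n G) → ℕ → Set where
  here : ∀ {u} → Walk G u u 0
  step : ∀ {u v x l} → Edge G u v → Walk G v x l → Walk G u x (wt G u v + l)

DistLE : (G : RawWG) → Fin (n G) → Fin (n G) → ℕ → Set
DistLE G u v h = ∃[ l ] (Walk G u v l × l ≤ h)

DistGE : (G : RawWG) → Fin (n G) → Fin (n G) → ℕ → Set
DistGE G u v h = ∀ l → Walk G u v l → h ≤ l

record IsWeightedGraph (G : RawWG) : Set where
  field
    loopless    : ∀ u → wt G u u ≡ 0
    symmetric   : ∀ u v → wt G u v ≡ wt G v u
    weightMinimal : ∀ u v → Edge G u v → DistGE G u v (wt G u v)

Connected : RawWG → Set
Connected G = ∀ u v → ∃[ l ] Walk G u v l

hamming : ∀ {m} → Vec Bool m → Vec Bool m → ℕ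
hamming [] [] = 0
hamming (true ∷ a) (true ∷ b) = hamming a b
hamming (false ∷ a) (false ∷ b) = hamming a b
hamming (true ∷ a) (false ∷ b) = suc (hamming a b)
hamming (false ∷ a) (true ∷ b) = suc (hamming a b)

IsAddressing : (G : RawWG) (m : ℕ) → (Fin (n G) → Vec Bool m) → Set
IsAddressing G m f = ∀ u v → DistLE G u v (hamming (f u) (f v))

IsC : RawWG → ℕ → Set
IsC G m = (Σ (Fin (n G) → Vec Bool m) (IsAddressing G m))
        × (∀ m' (f : Fin (n G) → Vec Bool m') → IsAddressing G m' f → m ≤ m')

IsDiam : RawWG → ℕ → Set
IsDiam G D = (∀ u v → DistLE G u v D) × (∃[ u ] ∃[ v ] DistGE G u v D)

-- Weighted Cartesian product; vertex a of Fin (n₁ * n₂) is the pair remQuot a.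
_□_ : RawWG → RawWG → RawWG
G □ H = record { n = n G * n H ; wt = w }
  where
  w : Fin (n G * n H) → Fin (n G * n H) → ℕ
  w a b with remQuot {n G} (n H) a | remQuot {n G} (n H) b
  ... | (u , x) | (v , y) =
    if does (x ≟ y) then wt G u v
    else (if does (u ≟ v) then wt H x y else 0)

-- Iterated product □_{i=1}^{k} G_i of k ≥ 1 graphs (indexed by Fin (suc k)).
□ⁱ : ∀ k → (Fin (suc k) → RawWG) → RawWG
□ⁱ zero    Gs = Gs zero
□ⁱ (suc k) Gs = Gs zero □ □ⁱ k (λ i → Gs (suc i))

Σⁱ : ∀ k → (Fin k → ℕ) → ℕ
Σⁱ k c = sum (tabulate c)

{-# OPTIONS --safe #-}
-- Every binary addressing of a graph has length at least its diameter, since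
-- the Hamming distance of two words is at most their length.  Concatenating
-- addressings of the factors addresses the product, so c is subadditive
-- under □; and a walk in G □ H splits into walks in G and in H, so
-- distances, hence diameters, add under □.  Together:
--   Σ c(Gᵢ) ≥ c(□ Gᵢ) ≥ diam(□ Gᵢ) ≥ Σ diam(Gᵢ) = Σ c(Gᵢ).
module Submission where

open import Defs
open import Data.Nat using (ℕ; zero; suc; _+_; _≤_; _<_; z≤n; s≤s)
open import Data.Nat.Properties
  using (+-identityʳ; +-assoc; +-commutativeSemigroup; +-mono-≤; +-monoʳ-≤; ≤-trans; m≤n+m; m≤n⇒m≤1+n; <-irrefl)
open import Algebra.Properties.CommutativeSemigroup +-commutativeSemigroup using (x∙yz≈y∙xz)
open import Data.Fin using (Fin; zero; suc; combine; remQuot; _≟_)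
open import Data.Fin.Properties using (remQuot-combine; combine-remQuot)
open import Data.Bool using (Bool; true; false; if_then_else_)
open import Data.Vec using (Vec; []; _∷_; _++_)
open import Data.Product using (Σ; ∃-syntax; _×_; _,_; proj₁; proj₂)
open import Data.Empty using (⊥-elim)
open import Function using (_∘_)
open import Relation.Nullary using (does; yes; no)
open import Relation.Nullary.Decidable using (dec-true; dec-false)
open import Relation.Binary.PropositionalEquality
  using (_≡_; _≢_; refl; sym; cong; cong₂; subst; subst₂)

hamming-++ : ∀ {m₁ m₂} (a c : Vec Bool m₁) (b d : Vec Bool m₂) →
             hamming (a ++ b) (c ++ d) ≡ hamming a c + hamming b d
hamming-++ []          []          b d = refl
hamming-++ (true ∷ a)  (true ∷ c)  b d = hamming-++ a c b d
hamming-++ (false ∷ a) (false ∷ c) b d = hamming-++ a c b d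
hamming-++ (true ∷ a)  (false ∷ c) b d = cong suc (hamming-++ a c b d)
hamming-++ (false ∷ a) (true ∷ c)  b d = cong suc (hamming-++ a c b d)

hamming≤length : ∀ {m} (a b : Vec Bool m) → hamming a b ≤ m
hamming≤length []          []          = z≤n
hamming≤length (true ∷ a)  (true ∷ b)  = m≤n⇒m≤1+n (hamming≤length a b)
hamming≤length (false ∷ a) (false ∷ b) = m≤n⇒m≤1+n (hamming≤length a b)
hamming≤length (true ∷ a)  (false ∷ b) = s≤s (hamming≤length a b)
hamming≤length (false ∷ a) (true ∷ b)  = s≤s (hamming≤length a b)

module _ {G : RawWG} where

  step-with : ∀ {u v x l w} → wt G u v ≡ w → 0 < w → Walk G v x l → Walk G u x (w + l)
  step-with refl e p = step e p

  _++ʷ_ : ∀ {u v x l₁ l₂} → Walk G u v l₁ → Walk G v x l₂ → Walk G u x (l₁ + l₂)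
  here ++ʷ q = q
  _++ʷ_ {l₂ = l₂} (step {l = l} e p) q = subst (Walk G _ _) (sym (+-assoc _ l l₂)) (step e (p ++ʷ q))

  DistLE-mono : ∀ {u v h h′} → h ≤ h′ → DistLE G u v h → DistLE G u v h′
  DistLE-mono h≤h′ (l , p , l≤h) = l , p , ≤-trans l≤h h≤h′

  DistLE-trans : ∀ {u v x h₁ h₂} → DistLE G u v h₁ → DistLE G v x h₂ → DistLE G u x (h₁ + h₂)
  DistLE-trans (l₁ , p , l₁≤h₁) (l₂ , q , l₂≤h₂) = l₁ + l₂ , p ++ʷ q , +-mono-≤ l₁≤h₁ l₂≤h₂

HasAddressing : RawWG → ℕ → Set
HasAddressing G m = Σ (Fin (n G) → Vec Bool m) (IsAddressing G m)

FarPair : RawWG → ℕ → Set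
FarPair G D = ∃[ u ] ∃[ v ] DistGE G u v D

FarPair⇒≤addressingLength : ∀ {G D m} → FarPair G D → HasAddressing G m → D ≤ m
FarPair⇒≤addressingLength (u , v , D≤d) (f , isAddr) with isAddr u v
... | l , p , l≤h = ≤-trans (D≤d l p) (≤-trans l≤h (hamming≤length (f u) (f v)))

IsC-intro : ∀ {G m} → HasAddressing G m → FarPair G m → IsC G m
IsC-intro addr far = addr , λ m′ f′ isAddr′ → FarPair⇒≤addressingLength far (f′ , isAddr′)

module _ {G H : RawWG} where

  π₁ : Fin (n (G □ H)) → Fin (n G)
  π₁ a = proj₁ (remQuot {n G} (n H) a)

  π₂ : Fin (n (G □ H)) → Fin (n H)
  π₂ a = proj₂ (remQuot {n G} (n H) a)

  π₁-combine : ∀ (u : Fin (n G)) x → π₁ (combine u x) ≡ u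
  π₁-combine u x = cong proj₁ (remQuot-combine {k = n H} u x)

  π₂-combine : ∀ (u : Fin (n G)) x → π₂ (combine u x) ≡ x
  π₂-combine u x = cong proj₂ (remQuot-combine {k = n H} u x)

  wt-□-combine : ∀ u x v y → wt (G □ H) (combine u x) (combine v y)
                             ≡ (if does (x ≟ y) then wt G u v else (if does (u ≟ v) then wt H x y else 0))
  wt-□-combine u x v y = cong₂ weight (remQuot-combine u x) (remQuot-combine v y)
    where
    -- wt (G □ H) is definitionally this function composed with remQuot.
    weight : Fin (n G) × Fin (n H) → Fin (n G) × Fin (n H) → ℕ
    weight (u , x) (v , y) = if does (x ≟ y) then wt G u v else (if does (u ≟ v) then wt H x y else 0)

  wt-□-horizontal : ∀ u v x → wt (G □ H) (combine u x) (combine v x) ≡ wt G u v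
  wt-□-horizontal u v x rewrite wt-□-combine u x v x | dec-true (x ≟ x) refl = refl

  wt-□-vertical : ∀ u {x y} → x ≢ y → wt (G □ H) (combine u x) (combine u y) ≡ wt H x y
  wt-□-vertical u {x} {y} x≢y
    rewrite wt-□-combine u x u y | dec-false (x ≟ y) x≢y | dec-true (u ≟ u) refl = refl

  walk-□-horizontal : ∀ {u v l} x → Walk G u v l → Walk (G □ H) (combine u x) (combine v x) l
  walk-□-horizontal x here = here
  walk-□-horizontal x (step {u} {v} e p) =
    step-with (wt-□-horizontal u v x) e (walk-□-horizontal x p)

  -- Loops of H (excluded only by looplessness, which is not assumed) are dropped.
  walk-□-vertical : ∀ u {x y l} → Walk H x y l → DistLE (G □ H) (combine u x) (combine u y) l
  walk-□-vertical u here = 0 , here , z≤n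
  walk-□-vertical u (step {x} {y} e p) with walk-□-vertical u p | x ≟ y
  ... | l′ , p′ , l′≤l | yes refl = l′ , p′ , ≤-trans l′≤l (m≤n+m _ (wt H x x))
  ... | l′ , p′ , l′≤l | no x≢y   = _ , step-with (wt-□-vertical u x≢y) e p′ , +-monoʳ-≤ (wt H x y) l′≤l

  DistLE-□ : ∀ {a b h₁ h₂} → DistLE G (π₁ a) (π₁ b) h₁ → DistLE H (π₂ a) (π₂ b) h₂ →
             DistLE (G □ H) a b (h₁ + h₂)
  DistLE-□ {a} {b} (l₁ , p₁ , l₁≤h₁) (l₂ , p₂ , l₂≤h₂) =
    subst₂ (λ s t → DistLE (G □ H) s t _) (combine-remQuot {n G} (n H) a) (combine-remQuot {n G} (n H) b)
      (DistLE-trans (l₁ , walk-□-horizontal (π₂ a) p₁ , l₁≤h₁)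
                    (DistLE-mono l₂≤h₂ (walk-□-vertical (π₁ b) p₂)))

  walk-□-split : ∀ {a b l} → Walk (G □ H) a b l →
    ∃[ l₁ ] ∃[ l₂ ] (Walk G (π₁ a) (π₁ b) l₁ × Walk H (π₂ a) (π₂ b) l₂ × l₁ + l₂ ≡ l)
  walk-□-split here = 0 , 0 , here , here , refl
  walk-□-split (step {u = a} {v = c} e p) with walk-□-split p | π₂ a ≟ π₂ c | π₁ a ≟ π₁ c
  ... | l₁ , l₂ , p₁ , p₂ , refl | yes x≡y | _ =
    _ , l₂ , step e p₁ , subst (λ z → Walk H z _ l₂) (sym x≡y) p₂ , +-assoc _ l₁ l₂
  ... | l₁ , l₂ , p₁ , p₂ , refl | no _ | yes u≡v =
    l₁ , _ , subst (λ z → Walk G z _ l₁) (sym u≡v) p₁ , step e p₂ , x∙yz≈y∙xz l₁ _ l₂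
  ... | _ | no _ | no _ = ⊥-elim (<-irrefl refl e)

  DistGE-□ : ∀ {a b D₁ D₂} → DistGE G (π₁ a) (π₁ b) D₁ → DistGE H (π₂ a) (π₂ b) D₂ →
             DistGE (G □ H) a b (D₁ + D₂)
  DistGE-□ D₁≤d₁ D₂≤d₂ l p with walk-□-split p
  ... | l₁ , l₂ , p₁ , p₂ , refl = +-mono-≤ (D₁≤d₁ l₁ p₁) (D₂≤d₂ l₂ p₂)

  addressing-□ : ∀ {m₁ m₂} → HasAddressing G m₁ → HasAddressing H m₂ → HasAddressing (G □ H) (m₁ + m₂)
  addressing-□ (f₁ , isAddr₁) (f₂ , isAddr₂) = f , isAddr
    where
    f : Fin (n (G □ H)) → Vec Bool _
    f a = f₁ (π₁ a) ++ f₂ (π₂ a)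

    isAddr : IsAddressing (G □ H) _ f
    isAddr a b = subst (DistLE (G □ H) a b) (sym (hamming-++ (f₁ (π₁ a)) (f₁ (π₁ b)) (f₂ (π₂ a)) (f₂ (π₂ b))))
                   (DistLE-□ (isAddr₁ (π₁ a) (π₁ b)) (isAddr₂ (π₂ a) (π₂ b)))

  farPair-□ : ∀ {D₁ D₂} → FarPair G D₁ → FarPair H D₂ → FarPair (G □ H) (D₁ + D₂)
  farPair-□ {D₁} {D₂} (u , v , D₁≤d₁) (x , y , D₂≤d₂) =
    combine u x , combine v y ,
    DistGE-□ (subst₂ (λ s t → DistGE G s t D₁) (sym (π₁-combine u x)) (sym (π₁-combine v y)) D₁≤d₁)
             (subst₂ (λ s t → DistGE H s t D₂) (sym (π₂-combine u x)) (sym (π₂-combine v y)) D₂≤d₂)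

□ⁱ-preserves : (P : RawWG → ℕ → Set) → (∀ {G H a b} → P G a → P H b → P (G □ H) (a + b)) →
               ∀ k {Gs cs} → (∀ i → P (Gs i) (cs i)) → P (□ⁱ k Gs) (Σⁱ (suc k) cs)
□ⁱ-preserves P _ zero {Gs} {cs} p = subst (P (Gs zero)) (sym (+-identityʳ (cs zero))) (p zero)
□ⁱ-preserves P _∙_ (suc k) p = p zero ∙ □ⁱ-preserves P _∙_ k (p ∘ suc)

corollary11 : (k : ℕ) (Gs : Fin (suc k) → RawWG) (cs : Fin (suc k) → ℕ)
    → (∀ i → IsWeightedGraph (Gs i))
    → (∀ i → Connected (Gs i))
    → (∀ i → IsC (Gs i) (cs i))
    → (∀ i → IsDiam (Gs i) (cs i))
    → IsC (□ⁱ k Gs) (Σⁱ (suc k) cs)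
corollary11 k Gs cs _ _ isC isDiam =
  IsC-intro (□ⁱ-preserves HasAddressing addressing-□ k (proj₁ ∘ isC))
            (□ⁱ-preserves FarPair farPair-□ k (proj₂ ∘ isDiam))
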